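{- In Algorithm I (see context), suppose that while processing constraint $h$ the dual update reaches step (b)(ii) for some $i\in T_h$. Then the index $k_i$ is well defined, the set $P_i$ is non-empty, and (with $y$ the current dual values at that moment) $$3\le \frac{\sum_{j\in P_i}a_{ij}y_j}{c_i\log k}\le 5.$$
   Context: Online covering LP without upper bounds: $n$ variables with costs $c_i>0$; constraints $\sum_{i=1}^n a_{ij}x_i\ge 1$ ($a_{ij}\ge 0$) arrive one at a time, $j=1,2,\dots$; $T_j=\{i:a_{ij}>0\}$, assumed nonempty; $a_{ij}=0$ for $i\notin T_j$. $\log=\log_2$. Algorithm I maintains $x\in\mathbb{R}^n_{\ge0}$ (initially $0$) and dual values $y_j\ge0$ for arrived constraints. When constraint $h$ arrives: set $k$ to the smallest power of $2$ at least $\max\{2,|T_1|,\dots,|T_h|\}$; let $d_{ih}=c_i/a_{ih}$ for $i\in T_h$, $d_{m(h)}=\min_{i\in T_h}d_{ih}$. Primal update: while $\sum_ia_{ih}x_i<1$, replace simultaneously for all $i\in T_h$: $x_i\leftarrow(1+d_{m(h)}/d_{ih})x_i+\frac{1}{ka_{ih}}\frac{d_{m(h)}}{d_{ih}}$; $t_h$ is the number of iterations. Dual update: if $t_h=0$, set $y_h=0$ and change nothing else. Otherwise (a) set $y_h\leftarrow d_{m(h)}t_h$; (b) for each $i\in T_h$ (in any order, each time using the current $y$-values): (i) if $\sum_{j<h}a_{ij}y_j\le(10\log k)c_i$, do nothing; (ii) otherwise let $k_i<h$ be the largest index with $\sum_{j\le k_i}a_{ij}y_j\le(5\log k)c_i$,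 let $P_i=\{j\le k_i: i\in T_j\}$, and for every $j\in P_i$ set $y_j\leftarrow(1-d_{m(h)}/d_{ih})\,y_j$.
   Formalization: The costs $c_i$ and the coefficients $a_{ij}$ are rational instead of real, so the primal values x and the dual values y are rational as well. -}

module Defs where

open import Data.Nat as ℕ using (ℕ; zero; suc; _∸_; _⊔_; _^_)
open import Data.Nat.Logarithm using (⌈log₂_⌉)
open import Data.Integer using (+_)
open import Data.Fin using (Fin)
open import Data.List using (List; []; _∷_; foldr; filter; length; map)
open import Data.List.Base using (allFin)
open import Data.List.Relation.Unary.Unique.Propositional using (Unique)
open import Data.List.Membership.Propositional using (_∈_)
open import Data.Rational as ℚ using (ℚ; 0ℚ; 1ℚ; _+_; _*_; _-_; _⊓_; _÷_; _<_; _≤_; ≢-nonZero)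
open import Data.Rational.Properties using (_≟_; _<?_)
open import Data.Product using (Σ; ∃; _×_; _,_)
open import Function.Bundles using (_⇔_)
open import Relation.Nullary using (yes; no; does)
open import Data.Bool using (if_then_else_; _∧_)
open import Relation.Binary.PropositionalEquality using (_≡_)

ℕtoℚ : ℕ → ℚ
ℕtoℚ m = (+ m) ℚ./ 1

-- total division (only ever used with nonzero divisor: c i > 0, a h i > 0)
_÷'_ : ℚ → ℚ → ℚ
p ÷' q with q ≟ 0ℚ
... | yes _ = 0ℚ
... | no q≢0 = _÷_ p q {{≢-nonZero q≢0}}

sumQ : List ℚ → ℚ
sumQ = foldr _+_ 0ℚ

-- Σ_{j=1}^{K} f j   (constraints are indexed 1,2,3,...)
sumTo : ℕ → (ℕ → ℚ) → ℚ
sumTo zero    f = 0ℚ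
sumTo (suc K) f = sumTo K f + f (suc K)

-- minimum of a list (default 0 for the empty list; never used on [])
minQ : List ℚ → ℚ
minQ []       = 0ℚ
minQ (x ∷ xs) = foldr _⊓_ x xs

set : (ℕ → ℚ) → ℕ → ℚ → (ℕ → ℚ)
set y h v j with does (j ℕ.≟ h)
... | Data.Bool.true  = v
... | Data.Bool.false = y j

-- Algorithm I for costs c and constraint matrix a.
-- a j i = a_{ij}: coefficient of variable i in constraint j (j = 1,2,...; a 0 is unused).
module AlgorithmI {n : ℕ} (c : Fin n → ℚ) (a : ℕ → Fin n → ℚ) where

  T : ℕ → List (Fin n)
  T j = filter (λ i → 0ℚ <? a j i) (allFin n)

  maxSize : ℕ → ℕ
  maxSize zero    = 2
  maxSize (suc h) = maxSize h ⊔ length (T (suc h))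

  logk : ℕ → ℕ
  logk h = ⌈log₂ maxSize h ⌉

  k : ℕ → ℕ
  k h = 2 ^ logk h

  d : ℕ → Fin n → ℚ
  d h i = c i ÷' a h i

  dm : ℕ → ℚ
  dm h = minQ (map (d h) (T h))

  lhs : ℕ → (Fin n → ℚ) → ℚ
  lhs h x = sumQ (map (λ i → a h i * x i) (allFin n))

  stepX : ℕ → (Fin n → ℚ) → (Fin n → ℚ)
  stepX h x i with 0ℚ <? a h i
  ... | yes _ = (1ℚ + (dm h ÷' d h i)) * x i
                + (1ℚ ÷' (ℕtoℚ (k h) * a h i)) * (dm h ÷' d h i)
  ... | no _  = x i

  iterX : ℕ → (Fin n → ℚ) → ℕ → (Fin n → ℚ)
  iterX h x zero    = x
  iterX h x (suc t) = stepX h (iterX h x t)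

  -- the while loop started at x runs exactly t iterations
  PrimalRuns : ℕ → (Fin n → ℚ) → ℕ → Set
  PrimalRuns h x t =
    (∀ s → s ℕ.< t → lhs h (iterX h x s) < 1ℚ) × (1ℚ ≤ lhs h (iterX h x t))

  S : (ℕ → ℚ) → Fin n → ℕ → ℚ
  S y i K = sumTo K (λ j → a j i * y j)

  -- Σ_{j ∈ P_i} a_{ij} y_j  with  P_i = { j ≤ K : i ∈ T_j }
  SP : (ℕ → ℚ) → Fin n → ℕ → ℚ
  SP y i K = sumTo K (λ j → if does (0ℚ <? a j i) then a j i * y j else 0ℚ)

  IsKi : ℕ → (ℕ → ℚ) → Fin n → ℕ → Set
  IsKi h y i K =
    (1 ℕ.≤ K) × (K ℕ.< h) × (S y i K ≤ ℕtoℚ (5 ℕ.* logk h) * c i) ×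
    (∀ K' → K ℕ.< K' → K' ℕ.< h → ℕtoℚ (5 ℕ.* logk h) * c i < S y i K')

  scale : ℕ → Fin n → ℕ → (ℕ → ℚ) → (ℕ → ℚ)
  scale h i K y j =
    if does (1 ℕ.≤? j) ∧ does (j ℕ.≤? K) ∧ does (0ℚ <? a j i)
    then (1ℚ - (dm h ÷' d h i)) * y j
    else y j

  -- step (b) of the dual update of constraint h, for variable i
  data DualStep (h : ℕ) (i : Fin n) (y : ℕ → ℚ) : (ℕ → ℚ) → Set where
    case-i  : S y i (h ∸ 1) ≤ ℕtoℚ (10 ℕ.* logk h) * c i → DualStep h i y y
    case-ii : ℕtoℚ (10 ℕ.* logk h) * c i < S y i (h ∸ 1) →
              ∀ K → IsKi h y i K → DualStep h i y (scale h i K y)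

  data DualSteps (h : ℕ) : List (Fin n) → (ℕ → ℚ) → (ℕ → ℚ) → Set where
    []  : ∀ {y} → DualSteps h [] y y
    _∷_ : ∀ {i is y y' y''} → DualStep h i y y' → DualSteps h is y' y'' →
          DualSteps h (i ∷ is) y y''

  OrderOf : ℕ → List (Fin n) → Set
  OrderOf h ℓ = Unique ℓ × (∀ i → (i ∈ ℓ) ⇔ (0ℚ < a h i))

  -- Reach h x y : (x, y) is a possible state after constraints 1..h are processed
  data Reach : ℕ → (Fin n → ℚ) → (ℕ → ℚ) → Set where
    init : Reach 0 (λ _ → 0ℚ) (λ _ → 0ℚ)
    noop : ∀ {h x y} → Reach h x y → PrimalRuns (suc h) x 0 →
           Reach (suc h) x (set y (suc h) 0ℚ)
    run  : ∀ {h x y t ℓ y'} → Reach h x y → PrimalRuns (suc h) x (suc t) →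
           OrderOf (suc h) ℓ →
           DualSteps (suc h) ℓ (set y (suc h) (dm (suc h) * ℕtoℚ (suc t))) y' →
           Reach (suc h) (iterX (suc h) x (suc t)) y'

-- The dual values stay under control for the whole run: every y_j is nonnegative and
-- a_{ij} y_j ≤ c_i (log k + 1).  A fresh value y_h = d_{m(h)} t_h obeys this since
-- a_{ih} d_{m(h)} ≤ a_{ih} d_{ih} = c_i and t_h ≤ log k: for a variable attaining d_{m(h)} the
-- quantity a x k + 1 doubles in every iteration, while a x < 1 before the last one.  Step (ii)
-- only rescales by factors in [0, 1], and k never decreases.
-- Hence the prefix sums Σ_{j ≤ K} a_{ij} y_j grow by at most 2 c_i log k per index.  In case (ii)
-- they exceed 10 c_i log k at K = h - 1, so the last K with prefix sum at most 5 c_i log k is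
-- below h - 1, is at least 1 (the sum at K = 1 is at most 2 c_i log k), and its prefix sum
-- exceeds (5 - 2) c_i log k.  As a_{ij} = 0 off T_j, that prefix sum is the sum over P_i.

module Submission where

open import Defs
open import Level using (0ℓ)
open import Data.Bool as Bool using (Bool; true; false; if_then_else_)
open import Data.Empty using (⊥-elim)
open import Data.Fin using (Fin)
open import Data.Integer as ℤ using (+_)
import Data.Integer.Properties as ℤ
open import Data.List using (List; []; _∷_; _++_; map)
open import Data.List.Base using (allFin)
open import Data.List.Membership.Propositional using (_∈_)
open import Data.List.Membership.Propositional.Properties
  using (∈-map⁺; ∈-map⁻; ∈-++⁺ˡ; ∈-filter⁺; ∈-filter⁻; ∈-allFin; foldr-selective)
open import Data.List.Properties using (foldr-preservesᵒ)
open import Data.List.Relation.Unary.All as All using (All)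
open import Data.List.Relation.Unary.All.Properties using (map⁺)
open import Data.List.Relation.Unary.Any as Any using (here; there)
open import Data.Nat as ℕ using (ℕ; zero; suc; z≤n; s≤s; _∸_)
import Data.Nat.Properties as ℕ
import Data.Nat.Coprimality as Coprime
open import Data.Nat.Logarithm using (⌈log₂⌉-mono-≤)
open import Data.Product using (Σ; ∃; _×_; _,_; proj₂)
open import Data.Rational as ℚ using (ℚ; mkℚ; 0ℚ; 1ℚ; _+_; _*_; _-_; -_; _<_; _≤_; _⊓_; 1/_)
open import Data.Rational.Properties
import Data.Rational.Unnormalised as ℚᵘ
import Data.Rational.Unnormalised.Properties as ℚᵘ
open import Data.Sum using (_⊎_; inj₁; inj₂; [_,_])
open import Function.Bundles using (Equivalence)
open import Relation.Binary.Definitions using (tri<; tri≈; tri>)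
open import Relation.Binary.PropositionalEquality
  using (_≡_; refl; sym; trans; cong; cong₂; subst; subst₂; module ≡-Reasoning)
open import Relation.Nullary using (yes; no; ¬_; Dec; does)
open import Relation.Nullary.Decidable using (dec⇒maybe)
open import Relation.Unary using (Decidable)
open import Tactic.RingSolver using (solve-∀)
open import Tactic.RingSolver.Core.AlmostCommutativeRing
  using (AlmostCommutativeRing; fromCommutativeRing)

ℚ-ring : AlmostCommutativeRing 0ℓ 0ℓ
ℚ-ring = fromCommutativeRing +-*-commutativeRing (λ x → dec⇒maybe (0ℚ ≟ x))

<⇒≱′ : ∀ {p q} → p < q → ¬ (q ≤ p)
<⇒≱′ p<q q≤p = <-irrefl refl (<-≤-trans p<q q≤p)

+-nonNeg′ : ∀ {p q} → 0ℚ ≤ p → 0ℚ ≤ q → 0ℚ ≤ p + q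
+-nonNeg′ = +-mono-≤

p≤p+q′ : ∀ {p q} → 0ℚ ≤ q → p ≤ p + q
p≤p+q′ {p} {q} q≥0 = subst (_≤ p + q) (+-identityʳ p) (+-monoʳ-≤ p q≥0)

p≤q+p′ : ∀ {p q} → 0ℚ ≤ q → p ≤ q + p
p≤q+p′ {p} {q} q≥0 = subst (p ≤_) (+-comm p q) (p≤p+q′ q≥0)

+-cancelʳ-<′ : ∀ {p q r} → p + r < q + r → p < q
+-cancelʳ-<′ {p} {q} {r} lt = ≰⇒> λ q≤p → <⇒≱′ lt (+-monoˡ-≤ r q≤p)

*-nonNeg′ : ∀ {p q} → 0ℚ ≤ p → 0ℚ ≤ q → 0ℚ ≤ p * q
*-nonNeg′ {p} {q} p≥0 q≥0 =
  nonNegative⁻¹ (p * q) {{nonNeg*nonNeg⇒nonNeg p {{ℚ.nonNegative p≥0}} q {{ℚ.nonNegative q≥0}}}}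

*-monoˡ-≤-nonNeg′ : ∀ {r p q} → 0ℚ ≤ r → p ≤ q → r * p ≤ r * q
*-monoˡ-≤-nonNeg′ {r} r≥0 = *-monoˡ-≤-nonNeg r {{ℚ.nonNegative r≥0}}

*-monoʳ-≤-nonNeg′ : ∀ {r p q} → 0ℚ ≤ r → p ≤ q → p * r ≤ q * r
*-monoʳ-≤-nonNeg′ {r} r≥0 = *-monoʳ-≤-nonNeg r {{ℚ.nonNegative r≥0}}

*-monoˡ-<-pos′ : ∀ {r p q} → 0ℚ < r → p < q → p * r < q * r
*-monoˡ-<-pos′ {r} r>0 = *-monoˡ-<-pos r {{ℚ.positive r>0}}

*-pos′ : ∀ {p q} → 0ℚ < p → 0ℚ < q → 0ℚ < p * q
*-pos′ {p} {q} p>0 q>0 = subst (_< p * q) (*-zeroˡ q) (*-monoˡ-<-pos′ q>0 p>0)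

*-cancelˡ-≤-pos′ : ∀ {r p q} → 0ℚ < r → r * p ≤ r * q → p ≤ q
*-cancelˡ-≤-pos′ {r} r>0 = *-cancelˡ-≤-pos r {{ℚ.positive r>0}}

0ℚ<1ℚ : 0ℚ < 1ℚ
0ℚ<1ℚ = ℚ.*<* (ℤ.+<+ (s≤s z≤n))

ℕtoℚ≡mkℚ : ∀ m → ℕtoℚ m ≡ mkℚ (+ m) 0 (Coprime.sym (Coprime.1-coprimeTo m))
ℕtoℚ≡mkℚ m = normalize-coprime (Coprime.sym (Coprime.1-coprimeTo m))

ℕtoℚ-+ : ∀ m n → ℕtoℚ (m ℕ.+ n) ≡ ℕtoℚ m + ℕtoℚ n
ℕtoℚ-+ m n = toℚᵘ-injective (ℚᵘ.≃-trans same-fraction (ℚᵘ.≃-sym (toℚᵘ-homo-+ (ℕtoℚ m) (ℕtoℚ n))))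
  where
  same-fraction : ℚ.toℚᵘ (ℕtoℚ (m ℕ.+ n)) ℚᵘ.≃ ℚ.toℚᵘ (ℕtoℚ m) ℚᵘ.+ ℚ.toℚᵘ (ℕtoℚ n)
  same-fraction rewrite ℕtoℚ≡mkℚ m | ℕtoℚ≡mkℚ n | ℕtoℚ≡mkℚ (m ℕ.+ n) =
    ℚᵘ.*≡* (cong (ℤ._* + 1) (trans (ℤ.pos-+ m n)
      (sym (cong₂ ℤ._+_ (ℤ.*-identityʳ (+ m)) (ℤ.*-identityʳ (+ n))))))

ℕtoℚ-* : ∀ m n → ℕtoℚ (m ℕ.* n) ≡ ℕtoℚ m * ℕtoℚ n
ℕtoℚ-* m n = toℚᵘ-injective (ℚᵘ.≃-trans same-fraction (ℚᵘ.≃-sym (toℚᵘ-homo-* (ℕtoℚ m) (ℕtoℚ n))))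
  where
  same-fraction : ℚ.toℚᵘ (ℕtoℚ (m ℕ.* n)) ℚᵘ.≃ ℚ.toℚᵘ (ℕtoℚ m) ℚᵘ.* ℚ.toℚᵘ (ℕtoℚ n)
  same-fraction rewrite ℕtoℚ≡mkℚ m | ℕtoℚ≡mkℚ n | ℕtoℚ≡mkℚ (m ℕ.* n) =
    ℚᵘ.*≡* (cong (ℤ._* + 1) (ℤ.pos-* m n))

ℕtoℚ-nonNeg : ∀ m → 0ℚ ≤ ℕtoℚ m
ℕtoℚ-nonNeg m = nonNegative⁻¹ (ℕtoℚ m) {{normalize-nonNeg m 1}}

ℕtoℚ-mono-≤ : ∀ {m n} → m ℕ.≤ n → ℕtoℚ m ≤ ℕtoℚ n
ℕtoℚ-mono-≤ {m} {n} m≤n = begin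
  ℕtoℚ m                 ≤⟨ p≤p+q′ (ℕtoℚ-nonNeg (n ∸ m)) ⟩
  ℕtoℚ m + ℕtoℚ (n ∸ m)  ≡⟨ sym (ℕtoℚ-+ m (n ∸ m)) ⟩
  ℕtoℚ (m ℕ.+ (n ∸ m))   ≡⟨ cong ℕtoℚ (ℕ.m+[n∸m]≡n m≤n) ⟩
  ℕtoℚ n                 ∎
  where open ≤-Reasoning

ℕtoℚ-cancel-< : ∀ {m n} → ℕtoℚ m < ℕtoℚ n → m ℕ.< n
ℕtoℚ-cancel-< lt = ℕ.≰⇒> λ n≤m → <⇒≱′ lt (ℕtoℚ-mono-≤ n≤m)

ℕtoℚ-pos : ∀ {m} → 1 ℕ.≤ m → 0ℚ < ℕtoℚ m
ℕtoℚ-pos 1≤m = <-≤-trans 0ℚ<1ℚ (ℕtoℚ-mono-≤ 1≤m)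

*-÷′-cancel : ∀ p {q} → 0ℚ < q → q * (p ÷' q) ≡ p
*-÷′-cancel p {q} q>0 with q ≟ 0ℚ
... | yes q≡0 = ⊥-elim (<-irrefl (sym q≡0) q>0)
... | no q≢0 = begin
  q * (p * 1/ q)  ≡⟨ *-comm q _ ⟩
  p * 1/ q * q    ≡⟨ *-assoc p (1/ q) q ⟩
  p * (1/ q * q)  ≡⟨ cong (p *_) (*-inverseˡ q) ⟩
  p * 1ℚ          ≡⟨ *-identityʳ p ⟩
  p               ∎
  where
  open ≡-Reasoning
  instance
    q-nonZero : ℚ.NonZero q
    q-nonZero = ℚ.≢-nonZero q≢0

÷′-self : ∀ {q} → 0ℚ < q → q ÷' q ≡ 1ℚ
÷′-self {q} q>0 with q ≟ 0ℚ
... | yes q≡0 = ⊥-elim (<-irrefl (sym q≡0) q>0)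
... | no q≢0 = *-inverseʳ q {{ℚ.≢-nonZero q≢0}}

÷′-nonNeg : ∀ {p q} → 0ℚ ≤ p → 0ℚ ≤ q → 0ℚ ≤ p ÷' q
÷′-nonNeg {p} {q} p≥0 q≥0 with <-cmp 0ℚ q
... | tri< q>0 _ _ = *-cancelˡ-≤-pos′ q>0 (subst₂ _≤_ (sym (*-zeroʳ q)) (sym (*-÷′-cancel p q>0)) p≥0)
... | tri≈ _ refl _ = ≤-refl
... | tri> _ _ q<0 = ⊥-elim (<⇒≱′ q<0 q≥0)

÷′-≤-1 : ∀ {p q} → 0ℚ < q → p ≤ q → p ÷' q ≤ 1ℚ
÷′-≤-1 {p} {q} q>0 p≤q =
  *-cancelˡ-≤-pos′ q>0 (subst₂ _≤_ (sym (*-÷′-cancel p q>0)) (sym (*-identityʳ q)) p≤q)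

minQ-∈ : ∀ {z xs} → z ∈ xs → minQ xs ∈ xs
minQ-∈ {xs = x ∷ xs} _ with foldr-selective ⊓-sel x xs
... | inj₁ min≡x = here min≡x
... | inj₂ min∈xs = there min∈xs

minQ-≤ : ∀ {z xs} → z ∈ xs → minQ xs ≤ z
minQ-≤ {z} {x ∷ xs} z∈ = foldr-preservesᵒ ⊓-≤ x xs (head-or-tail z∈)
  where
  ⊓-≤ : ∀ p q → p ≤ z ⊎ q ≤ z → p ⊓ q ≤ z
  ⊓-≤ p q = [ ≤-trans (p⊓q≤p p q) , ≤-trans (p⊓q≤q p q) ]
  head-or-tail : z ∈ x ∷ xs → x ≤ z ⊎ Any.Any (_≤ z) xs
  head-or-tail (here refl) = inj₁ ≤-refl
  head-or-tail (there z∈xs) = inj₂ (Any.map (λ { refl → ≤-refl }) z∈xs)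

minQ-all : ∀ {P : ℚ → Set} {xs} → P 0ℚ → All P xs → P (minQ xs)
minQ-all {xs = []} P0 _ = P0
minQ-all {xs = x ∷ xs} _ Pxs = All.lookup Pxs (minQ-∈ (here refl))

≤-sumQ-map : ∀ {A : Set} (f : A → ℚ) → (∀ z → 0ℚ ≤ f z) → ∀ {z xs} → z ∈ xs → f z ≤ sumQ (map f xs)
≤-sumQ-map f f≥0 {xs = x ∷ xs} (here refl) = p≤p+q′ (sumQ-nonNeg xs)
  where
  sumQ-nonNeg : ∀ xs → 0ℚ ≤ sumQ (map f xs)
  sumQ-nonNeg [] = ≤-refl
  sumQ-nonNeg (x ∷ xs) = +-nonNeg′ (f≥0 x) (sumQ-nonNeg xs)
≤-sumQ-map f f≥0 {xs = x ∷ xs} (there z∈xs) =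
  ≤-trans (≤-sumQ-map f f≥0 z∈xs) (p≤q+p′ (f≥0 x))

sumTo-cong : ∀ K {f g : ℕ → ℚ} → (∀ j → f j ≡ g j) → sumTo K f ≡ sumTo K g
sumTo-cong zero f≗g = refl
sumTo-cong (suc K) f≗g = cong₂ _+_ (sumTo-cong K f≗g) (f≗g (suc K))

sumTo-pos⇒∃pos : ∀ K (f : ℕ → ℚ) → 0ℚ < sumTo K f → ∃ λ j → (1 ℕ.≤ j) × (j ℕ.≤ K) × (0ℚ < f j)
sumTo-pos⇒∃pos zero f 0<0 = ⊥-elim (<-irrefl refl 0<0)
sumTo-pos⇒∃pos (suc K) f sum>0 with 0ℚ <? f (suc K) | 0ℚ <? sumTo K f
... | yes fK>0 | _ = suc K , s≤s z≤n , ℕ.≤-refl , fK>0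
... | no _ | yes sumK>0 with sumTo-pos⇒∃pos K f sumK>0
...   | j , 1≤j , j≤K , fj>0 = j , 1≤j , ℕ.m≤n⇒m≤1+n j≤K , fj>0
sumTo-pos⇒∃pos (suc K) f sum>0 | no fK≯0 | no sumK≯0 =
  ⊥-elim (<⇒≱′ sum>0 (+-mono-≤ (≮⇒≥ sumK≯0) (≮⇒≥ fK≯0)))

LastUpTo : (P : ℕ → Set) → ℕ → ℕ → Set
LastUpTo P m K = K ℕ.≤ m × P K × (∀ K' → K ℕ.< K' → K' ℕ.≤ m → ¬ P K')

lastUpTo : ∀ {P : ℕ → Set} → Decidable P → P 0 → ∀ m → ∃ (LastUpTo P m)
lastUpTo P? P0 zero = 0 , z≤n , P0 , λ K' 0<K' K'≤0 → ⊥-elim (ℕ.<⇒≱ 0<K' K'≤0)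
lastUpTo {P} P? P0 (suc m) with P? (suc m)
... | yes Pm+1 = suc m , ℕ.≤-refl , Pm+1 , λ K' m+1<K' K'≤m+1 → ⊥-elim (ℕ.<⇒≱ m+1<K' K'≤m+1)
... | no ¬Pm+1 with lastUpTo P? P0 m
...   | K , K≤m , PK , after = K , ℕ.m≤n⇒m≤1+n K≤m , PK , after′
  where
  after′ : ∀ K' → K ℕ.< K' → K' ℕ.≤ suc m → ¬ P K'
  after′ K' K<K' K'≤m+1 with ℕ.m≤n⇒m<n∨m≡n K'≤m+1
  ... | inj₁ K'<m+1 = after K' K<K' (ℕ.≤-pred K'<m+1)
  ... | inj₂ refl = ¬Pm+1

LastPrefixBelow : (g : ℕ → ℚ) (B b : ℚ) (m K : ℕ) → Set
LastPrefixBelow g B b m K = (1 ℕ.≤ K) × (K ℕ.< m) × (sumTo K g ≤ b) ×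
  (∀ K' → K ℕ.< K' → K' ℕ.≤ m → b < sumTo K' g) × (b < sumTo K g + B)

lastPrefixBelow : (g : ℕ → ℚ) (B b : ℚ) (m : ℕ) → (∀ j → g j ≤ B) → 0ℚ ≤ B → B ≤ b → b < sumTo m g →
  ∃ (LastPrefixBelow g B b m)
lastPrefixBelow g B b m g≤B B≥0 B≤b b<sum[m] =
  window (lastUpTo (λ K → sumTo K g ≤? b) (≤-trans B≥0 B≤b) m)
  where
  sum[1]≤b : sumTo 1 g ≤ b
  sum[1]≤b = ≤-trans (≤-reflexive (+-identityˡ (g 1))) (≤-trans (g≤B 1) B≤b)

  K<m : ∀ {K} → K ℕ.≤ m → sumTo K g ≤ b → K ℕ.< m
  K<m K≤m sum[K]≤b with ℕ.m≤n⇒m<n∨m≡n K≤m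
  ... | inj₁ K<m = K<m
  ... | inj₂ refl = ⊥-elim (<⇒≱′ b<sum[m] sum[K]≤b)

  window : ∃ (LastUpTo (λ K → sumTo K g ≤ b) m) → ∃ (LastPrefixBelow g B b m)
  window (zero , 0≤m , sum[0]≤b , after) = ⊥-elim (after 1 (s≤s z≤n) (K<m 0≤m sum[0]≤b) sum[1]≤b)
  window (suc K , K+1≤m , sum[K+1]≤b , after) =
    suc K , s≤s z≤n , K<m K+1≤m sum[K+1]≤b , sum[K+1]≤b , above , overshoot
    where
    above : ∀ K' → suc K ℕ.< K' → K' ℕ.≤ m → b < sumTo K' g
    above K' K<K' K'≤m = ≰⇒> (after K' K<K' K'≤m)
    overshoot : b < sumTo (suc K) g + B
    overshoot = <-≤-trans (above (suc (suc K)) ℕ.≤-refl (K<m K+1≤m sum[K+1]≤b))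
                          (+-monoʳ-≤ (sumTo (suc K) g) (g≤B (suc (suc K))))

set-preserves : (P : ℕ → ℚ → Set) {y : ℕ → ℚ} {h : ℕ} {v : ℚ} →
  P h v → (∀ j → P j (y j)) → ∀ j → P j (set y h v j)
-- set tests does (j ℕ.≟ h), which computes to j ℕ.≡ᵇ h.
set-preserves P {h = h} {v} Pv Py j with j ℕ.≡ᵇ h in j≡ᵇh
... | true = subst (λ j → P j v) (sym (ℕ.≡ᵇ⇒≡ j h (subst Bool.T (sym j≡ᵇh) _))) Pv
... | false = Py j

if-preserves : {A : Set} (P : A → Set) (b : Bool) {u v : A} → P u → P v → P (if b then u else v)
if-preserves P true Pu Pv = Pu
if-preserves P false Pu Pv = Pv

module Analysis {n : ℕ} (c : Fin n → ℚ) (a : ℕ → Fin n → ℚ)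
  (c>0 : ∀ i → 0ℚ < c i) (a≥0 : ∀ j i → 0ℚ ≤ a j i)
  (T-nonempty : ∀ j → 1 ℕ.≤ j → ∃ λ i → 0ℚ < a j i) where

  open AlgorithmI c a

  c≥0 : ∀ i → 0ℚ ≤ c i
  c≥0 i = <⇒≤ (c>0 i)

  a≯0⇒a≡0 : ∀ {j i} → ¬ (0ℚ < a j i) → a j i ≡ 0ℚ
  a≯0⇒a≡0 {j} {i} a≯0 = ≤-antisym (≮⇒≥ a≯0) (a≥0 j i)

  ∈T⁺ : ∀ {h i} → 0ℚ < a h i → i ∈ T h
  ∈T⁺ {h} {i} = ∈-filter⁺ (λ i → 0ℚ <? a h i) (∈-allFin i)

  ∈T⁻ : ∀ {h i} → i ∈ T h → 0ℚ < a h i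
  ∈T⁻ {h} i∈T with ∈-filter⁻ (λ i → 0ℚ <? a h i) {xs = allFin n} i∈T
  ... | _ , a>0 = a>0

  a*d≡c : ∀ {h i} → 0ℚ < a h i → a h i * d h i ≡ c i
  a*d≡c {h} {i} = *-÷′-cancel (c i)

  d≥0 : ∀ h i → 0ℚ ≤ d h i
  d≥0 h i = ÷′-nonNeg (c≥0 i) (a≥0 h i)

  d>0 : ∀ {h i} → 0ℚ < a h i → 0ℚ < d h i
  d>0 {h} {i} a>0 = ≰⇒> λ d≤0 → <⇒≱′ (c>0 i) (begin
    c i             ≡⟨ sym (a*d≡c a>0) ⟩
    a h i * d h i   ≤⟨ *-monoˡ-≤-nonNeg′ (a≥0 h i) d≤0 ⟩
    a h i * 0ℚ      ≡⟨ *-zeroʳ (a h i) ⟩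
    0ℚ              ∎)
    where open ≤-Reasoning

  dm≥0 : ∀ h → 0ℚ ≤ dm h
  dm≥0 h = minQ-all {0ℚ ≤_} ≤-refl (map⁺ {xs = T h} (All.tabulate λ {i} _ → d≥0 h i))

  dm≤d : ∀ {h i} → 0ℚ < a h i → dm h ≤ d h i
  dm≤d {h} a>0 = minQ-≤ (∈-map⁺ (d h) (∈T⁺ a>0))

  dm-attained : ∀ h → 1 ℕ.≤ h → ∃ λ m → 0ℚ < a h m × dm h ≡ d h m
  dm-attained h 1≤h with T-nonempty h 1≤h
  ... | i , a>0 with ∈-map⁻ (d h) (minQ-∈ (∈-map⁺ (d h) (∈T⁺ a>0)))
  ...   | m , m∈T , dm≡d = m , ∈T⁻ m∈T , dm≡d

  ratio≥0 : ∀ h i → 0ℚ ≤ dm h ÷' d h i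
  ratio≥0 h i = ÷′-nonNeg (dm≥0 h) (d≥0 h i)

  ratio≤1 : ∀ {h i} → 0ℚ < a h i → dm h ÷' d h i ≤ 1ℚ
  ratio≤1 a>0 = ÷′-≤-1 (d>0 a>0) (dm≤d a>0)

  ratio-attained : ∀ {h m} → 0ℚ < a h m → dm h ≡ d h m → dm h ÷' d h m ≡ 1ℚ
  ratio-attained {h} {m} a>0 dm≡d = trans (cong (_÷' d h m) dm≡d) (÷′-self (d>0 a>0))

  stepX-nonNeg : ∀ h x → (∀ i → 0ℚ ≤ x i) → ∀ i → 0ℚ ≤ stepX h x i
  stepX-nonNeg h x x≥0 i with 0ℚ <? a h i
  ... | no _ = x≥0 i
  ... | yes _ = +-nonNeg′ (*-nonNeg′ (+-nonNeg′ (<⇒≤ 0ℚ<1ℚ) (ratio≥0 h i)) (x≥0 i))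
                          (*-nonNeg′ (÷′-nonNeg (<⇒≤ 0ℚ<1ℚ) (*-nonNeg′ (ℕtoℚ-nonNeg (k h)) (a≥0 h i)))
                                     (ratio≥0 h i))

  iterX-nonNeg : ∀ h x → (∀ i → 0ℚ ≤ x i) → ∀ s i → 0ℚ ≤ iterX h x s i
  iterX-nonNeg h x x≥0 zero = x≥0
  iterX-nonNeg h x x≥0 (suc s) = stepX-nonNeg h (iterX h x s) (iterX-nonNeg h x x≥0 s)

  -- At a variable m attaining d_{m(h)} the update reads x ↦ 2x + 1/(k a_{mh}).
  stepX-doubles : ∀ h x {m} → 0ℚ < a h m → dm h ≡ d h m →
    a h m * stepX h x m * ℕtoℚ (k h) + 1ℚ ≡ (1ℚ + 1ℚ) * (a h m * x m * ℕtoℚ (k h) + 1ℚ)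
  stepX-doubles h x {m} a>0 dm≡d with 0ℚ <? a h m
  ... | no a≯0 = ⊥-elim (a≯0 a>0)
  ... | yes _ rewrite ratio-attained a>0 dm≡d = begin
    A * ((1ℚ + 1ℚ) * X + U * 1ℚ) * K + 1ℚ   ≡⟨ expand A X K U ⟩
    (1ℚ + 1ℚ) * (A * X * K) + K * A * U + 1ℚ ≡⟨ cong (λ z → (1ℚ + 1ℚ) * (A * X * K) + z + 1ℚ) K*A*U≡1 ⟩
    (1ℚ + 1ℚ) * (A * X * K) + 1ℚ + 1ℚ        ≡⟨ collect (A * X * K) ⟩
    (1ℚ + 1ℚ) * (A * X * K + 1ℚ)             ∎
    where
    open ≡-Reasoning
    A X K U : ℚ
    A = a h m
    X = x m
    K = ℕtoℚ (k h)
    U = 1ℚ ÷' (K * A)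
    K*A*U≡1 : K * A * U ≡ 1ℚ
    K*A*U≡1 = *-÷′-cancel 1ℚ (*-pos′ (ℕtoℚ-pos (ℕ.m^n>0 2 (logk h))) a>0)
    expand : ∀ A X K U → A * ((1ℚ + 1ℚ) * X + U * 1ℚ) * K + 1ℚ ≡ (1ℚ + 1ℚ) * (A * X * K) + K * A * U + 1ℚ
    expand = solve-∀ ℚ-ring
    collect : ∀ Y → (1ℚ + 1ℚ) * Y + 1ℚ + 1ℚ ≡ (1ℚ + 1ℚ) * (Y + 1ℚ)
    collect = solve-∀ ℚ-ring

  iterX-doubling : ∀ h x {m} → (∀ i → 0ℚ ≤ x i) → 0ℚ < a h m → dm h ≡ d h m → ∀ s →
    ℕtoℚ (2 ℕ.^ s) ≤ a h m * iterX h x s m * ℕtoℚ (k h) + 1ℚ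
  iterX-doubling h x {m} x≥0 a>0 dm≡d zero =
    p≤q+p′ (*-nonNeg′ (*-nonNeg′ (a≥0 h m) (x≥0 m)) (ℕtoℚ-nonNeg (k h)))
  iterX-doubling h x {m} x≥0 a>0 dm≡d (suc s) = begin
    ℕtoℚ (2 ℕ.* 2 ℕ.^ s)                              ≡⟨ ℕtoℚ-* 2 (2 ℕ.^ s) ⟩
    ℕtoℚ 2 * ℕtoℚ (2 ℕ.^ s)                           ≤⟨ *-monoˡ-≤-nonNeg′ (ℕtoℚ-nonNeg 2)
                                                          (iterX-doubling h x x≥0 a>0 dm≡d s) ⟩
    ℕtoℚ 2 * (a h m * iterX h x s m * ℕtoℚ (k h) + 1ℚ)  ≡⟨ sym (stepX-doubles h (iterX h x s) a>0 dm≡d) ⟩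
    a h m * iterX h x (suc s) m * ℕtoℚ (k h) + 1ℚ     ∎
    where open ≤-Reasoning

  a*x≤lhs : ∀ h x → (∀ i → 0ℚ ≤ x i) → ∀ m → a h m * x m ≤ lhs h x
  a*x≤lhs h x x≥0 m = ≤-sumQ-map (λ i → a h i * x i) (λ i → *-nonNeg′ (a≥0 h i) (x≥0 i)) (∈-allFin m)

  2^iterations≤k : ∀ h x t → (∀ i → 0ℚ ≤ x i) → PrimalRuns (suc h) x (suc t) → 2 ℕ.^ t ℕ.≤ k (suc h)
  2^iterations≤k h x t x≥0 (unsatisfied , _) with dm-attained (suc h) (s≤s z≤n)
  ... | m , a>0 , dm≡d = ℕ.≤-pred (subst (2 ℕ.^ t ℕ.<_) (ℕ.+-comm K 1) (ℕtoℚ-cancel-< (begin-strict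
    ℕtoℚ (2 ℕ.^ t)                          ≤⟨ iterX-doubling (suc h) x x≥0 a>0 dm≡d t ⟩
    a (suc h) m * X * ℕtoℚ K + 1ℚ           <⟨ +-monoˡ-< 1ℚ (*-monoˡ-<-pos′ (ℕtoℚ-pos (ℕ.m^n>0 2 (logk (suc h)))) a*X<1) ⟩
    1ℚ * ℕtoℚ K + 1ℚ                        ≡⟨ cong (_+ 1ℚ) (*-identityˡ (ℕtoℚ K)) ⟩
    ℕtoℚ K + 1ℚ                             ≡⟨ sym (ℕtoℚ-+ K 1) ⟩
    ℕtoℚ (K ℕ.+ 1)                          ∎)))
    where
    open ≤-Reasoning
    K : ℕ
    K = k (suc h)
    X : ℚ
    X = iterX (suc h) x t m
    a*X<1 : a (suc h) m * X < 1ℚ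
    a*X<1 = ≤-<-trans (a*x≤lhs (suc h) (iterX (suc h) x t) (iterX-nonNeg (suc h) x x≥0 t) m)
                      (unsatisfied t ℕ.≤-refl)

  iterations≤logk : ∀ h x t → (∀ i → 0ℚ ≤ x i) → PrimalRuns (suc h) x (suc t) → t ℕ.≤ logk (suc h)
  iterations≤logk h x t x≥0 runs = ℕ.≮⇒≥ λ logk<t →
    ℕ.<⇒≱ (ℕ.^-monoʳ-< 2 (s≤s (s≤s z≤n)) logk<t) (2^iterations≤k h x t x≥0 runs)

  logk-mono : ∀ h → logk h ℕ.≤ logk (suc h)
  logk-mono h = ⌈log₂⌉-mono-≤ (ℕ.m≤m⊔n (maxSize h) _)

  logk≥1 : ∀ h → 1 ℕ.≤ logk h
  logk≥1 h = ⌈log₂⌉-mono-≤ {2} (maxSize≥2 h)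
    where
    maxSize≥2 : ∀ h → 2 ℕ.≤ maxSize h
    maxSize≥2 zero = ℕ.≤-refl
    maxSize≥2 (suc h) = ℕ.≤-trans (maxSize≥2 h) (ℕ.m≤m⊔n (maxSize h) _)

  record DualBounded (L : ℕ) (y : ℕ → ℚ) : Set where
    constructor dualBounded
    field
      nonNeg  : ∀ j → 0ℚ ≤ y j
      bounded : ∀ j i → a j i * y j ≤ c i * ℕtoℚ (suc L)

  DualBounded-mono : ∀ {L L' y} → L ℕ.≤ L' → DualBounded L y → DualBounded L' y
  DualBounded-mono L≤L' (dualBounded y≥0 a*y≤) =
    dualBounded y≥0 λ j i → ≤-trans (a*y≤ j i) (*-monoˡ-≤-nonNeg′ (c≥0 i) (ℕtoℚ-mono-≤ (s≤s L≤L')))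

  DualBounded-set : ∀ {L y} h v → 0ℚ ≤ v → (∀ i → a h i * v ≤ c i * ℕtoℚ (suc L)) →
    DualBounded L y → DualBounded L (set y h v)
  DualBounded-set {L} h v v≥0 a*v≤ (dualBounded y≥0 a*y≤) = dualBounded
    (set-preserves (λ _ z → 0ℚ ≤ z) v≥0 y≥0)
    (λ j i → set-preserves (λ j z → a j i * z ≤ c i * ℕtoℚ (suc L)) (a*v≤ i) (λ j → a*y≤ j i) j)

  DualBounded-scale : ∀ {L y h i} K → 0ℚ < a h i → DualBounded L y → DualBounded L (scale h i K y)
  DualBounded-scale {L} {y} {h} {i} K a>0 (dualBounded y≥0 a*y≤) = dualBounded
    (λ j → if-preserves (0ℚ ≤_) _ (*-nonNeg′ f≥0 (y≥0 j)) (y≥0 j))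
    (λ j i' → if-preserves (λ z → a j i' * z ≤ c i' * ℕtoℚ (suc L)) _ (scaled j i') (a*y≤ j i'))
    where
    f : ℚ
    f = 1ℚ - (dm h ÷' d h i)
    f≥0 : 0ℚ ≤ f
    f≥0 = subst (_≤ f) (+-inverseʳ (dm h ÷' d h i)) (+-monoˡ-≤ (- (dm h ÷' d h i)) (ratio≤1 a>0))
    f≤1 : f ≤ 1ℚ
    f≤1 = subst (f ≤_) (+-identityʳ 1ℚ) (+-monoʳ-≤ 1ℚ (neg-antimono-≤ (ratio≥0 h i)))
    scaled : ∀ j i' → a j i' * (f * y j) ≤ c i' * ℕtoℚ (suc L)
    scaled j i' = begin
      a j i' * (f * y j)  ≡⟨ *-assoc-comm (a j i') f (y j) ⟩
      f * (a j i' * y j)  ≤⟨ *-monoʳ-≤-nonNeg′ (*-nonNeg′ (a≥0 j i') (y≥0 j)) f≤1 ⟩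
      1ℚ * (a j i' * y j) ≡⟨ *-identityˡ _ ⟩
      a j i' * y j        ≤⟨ a*y≤ j i' ⟩
      c i' * ℕtoℚ (suc L) ∎
      where
      open ≤-Reasoning
      *-assoc-comm : ∀ p q r → p * (q * r) ≡ q * (p * r)
      *-assoc-comm = solve-∀ ℚ-ring

  DualBounded-steps : ∀ {L h} ℓ {y y'} → (∀ {i} → i ∈ ℓ → 0ℚ < a h i) →
    DualSteps h ℓ y y' → DualBounded L y → DualBounded L y'
  DualBounded-steps [] _ [] bounds = bounds
  DualBounded-steps (i ∷ ℓ) ℓ⊆T (case-i _ ∷ steps) bounds =
    DualBounded-steps ℓ (λ i∈ℓ → ℓ⊆T (there i∈ℓ)) steps bounds
  DualBounded-steps (i ∷ ℓ) ℓ⊆T (case-ii _ K _ ∷ steps) bounds =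
    DualBounded-steps ℓ (λ i∈ℓ → ℓ⊆T (there i∈ℓ)) steps (DualBounded-scale K (ℓ⊆T (here refl)) bounds)

  newDual-bounded : ∀ h t → t ℕ.≤ logk h → ∀ i → a h i * (dm h * ℕtoℚ (suc t)) ≤ c i * ℕtoℚ (suc (logk h))
  newDual-bounded h t t≤logk i with 0ℚ <? a h i
  ... | no a≯0 = begin
    a h i * (dm h * ℕtoℚ (suc t)) ≡⟨ cong (_* (dm h * ℕtoℚ (suc t))) (a≯0⇒a≡0 a≯0) ⟩
    0ℚ * (dm h * ℕtoℚ (suc t))    ≡⟨ *-zeroˡ (dm h * ℕtoℚ (suc t)) ⟩
    0ℚ                            ≤⟨ *-nonNeg′ (c≥0 i) (ℕtoℚ-nonNeg (suc (logk h))) ⟩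
    c i * ℕtoℚ (suc (logk h))     ∎
    where open ≤-Reasoning
  ... | yes a>0 = begin
    a h i * (dm h * ℕtoℚ (suc t)) ≡⟨ *-assoc (a h i) (dm h) (ℕtoℚ (suc t)) ⟨
    a h i * dm h * ℕtoℚ (suc t)   ≤⟨ *-monoʳ-≤-nonNeg′ (ℕtoℚ-nonNeg (suc t)) (*-monoˡ-≤-nonNeg′ (a≥0 h i) (dm≤d a>0)) ⟩
    a h i * d h i * ℕtoℚ (suc t)  ≡⟨ cong (_* ℕtoℚ (suc t)) (a*d≡c a>0) ⟩
    c i * ℕtoℚ (suc t)            ≤⟨ *-monoˡ-≤-nonNeg′ (c≥0 i) (ℕtoℚ-mono-≤ (s≤s t≤logk)) ⟩
    c i * ℕtoℚ (suc (logk h))     ∎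
    where open ≤-Reasoning

  zero-bounded : ∀ {L} j i → a j i * 0ℚ ≤ c i * ℕtoℚ (suc L)
  zero-bounded {L} j i = subst (_≤ c i * ℕtoℚ (suc L)) (sym (*-zeroʳ (a j i))) (*-nonNeg′ (c≥0 i) (ℕtoℚ-nonNeg (suc L)))

  DualBounded-afterRun : ∀ {h x y t} → (∀ i → 0ℚ ≤ x i) → DualBounded (logk h) y →
    PrimalRuns (suc h) x (suc t) → DualBounded (logk (suc h)) (set y (suc h) (dm (suc h) * ℕtoℚ (suc t)))
  DualBounded-afterRun {h} {x} {t = t} x≥0 bounds runs =
    DualBounded-set (suc h) _ (*-nonNeg′ (dm≥0 (suc h)) (ℕtoℚ-nonNeg (suc t)))
      (newDual-bounded (suc h) t (iterations≤logk h x t x≥0 runs))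
      (DualBounded-mono (logk-mono h) bounds)

  Reach⇒primal-nonNeg : ∀ {h x y} → Reach h x y → ∀ i → 0ℚ ≤ x i
  Reach⇒primal-nonNeg init i = ≤-refl
  Reach⇒primal-nonNeg (noop reach _) = Reach⇒primal-nonNeg reach
  Reach⇒primal-nonNeg (run {h} {x} {t = t} reach _ _ _) =
    iterX-nonNeg (suc h) x (Reach⇒primal-nonNeg reach) (suc t)

  Reach⇒DualBounded : ∀ {h x y} → Reach h x y → DualBounded (logk h) y
  Reach⇒DualBounded init = dualBounded (λ _ → ≤-refl) (zero-bounded {logk 0})
  Reach⇒DualBounded (noop {h} reach _) =
    DualBounded-set (suc h) 0ℚ ≤-refl (zero-bounded {logk (suc h)} (suc h))
      (DualBounded-mono (logk-mono h) (Reach⇒DualBounded reach))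
  Reach⇒DualBounded (run {ℓ = ℓ} reach runs order steps) =
    DualBounded-steps ℓ (Equivalence.to (proj₂ order _)) steps
      (DualBounded-afterRun (Reach⇒primal-nonNeg reach) (Reach⇒DualBounded reach) runs)

  SP≡S : ∀ y i K → SP y i K ≡ S y i K
  SP≡S y i K = sumTo-cong K λ j → term j (0ℚ <? a j i)
    where
    term : ∀ j (a>0? : Dec (0ℚ < a j i)) → (if does a>0? then a j i * y j else 0ℚ) ≡ a j i * y j
    term j (yes _) = refl
    term j (no a≯0) = sym (trans (cong (_* y j) (a≯0⇒a≡0 a≯0)) (*-zeroˡ (y j)))

  SP-pos⇒P-nonempty : ∀ y i K → 0ℚ < SP y i K → ∃ λ j → (1 ℕ.≤ j) × (j ℕ.≤ K) × (0ℚ < a j i)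
  SP-pos⇒P-nonempty y i K SP>0 with sumTo-pos⇒∃pos K _ SP>0
  ... | j , 1≤j , j≤K , term>0 = j , 1≤j , j≤K , in-P (0ℚ <? a j i) term>0
    where
    in-P : (a>0? : Dec (0ℚ < a j i)) → 0ℚ < (if does a>0? then a j i * y j else 0ℚ) → 0ℚ < a j i
    in-P (yes a>0) _ = a>0
    in-P (no _) 0<0 = ⊥-elim (<-irrefl refl 0<0)

  Kᵢ-window : ∀ {h y i} → DualBounded (logk (suc h)) y →
    ℕtoℚ (10 ℕ.* logk (suc h)) * c i < S y i h →
    Σ ℕ λ K → IsKi (suc h) y i K × (∃ λ j → (1 ℕ.≤ j) × (j ℕ.≤ K) × (0ℚ < a j i)) ×
      (ℕtoℚ 3 * (c i * ℕtoℚ (logk (suc h))) ≤ SP y i K) ×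
      (SP y i K ≤ ℕtoℚ 5 * (c i * ℕtoℚ (logk (suc h))))
  Kᵢ-window {h} {y} {i} (dualBounded _ a*y≤) S[h]>10X =
    window (lastPrefixBelow (λ j → a j i * y j) (X + X) b h increment≤2X 2X≥0 2X≤b b<S[h])
    where
    L : ℕ
    L = logk (suc h)
    X b : ℚ
    X = c i * ℕtoℚ L
    b = ℕtoℚ (5 ℕ.* L) * c i

    X≥c : c i ≤ X
    X≥c = subst (_≤ X) (*-identityʳ (c i)) (*-monoˡ-≤-nonNeg′ (c≥0 i) (ℕtoℚ-mono-≤ (logk≥1 (suc h))))
    X≥0 : 0ℚ ≤ X
    X≥0 = ≤-trans (c≥0 i) X≥c
    2X≥0 : 0ℚ ≤ X + X
    2X≥0 = +-nonNeg′ X≥0 X≥0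
    3X≥0 : 0ℚ ≤ ℕtoℚ 3 * X
    3X≥0 = *-nonNeg′ (ℕtoℚ-nonNeg 3) X≥0

    b≡5X : b ≡ ℕtoℚ 5 * X
    b≡5X = trans (cong (_* c i) (ℕtoℚ-* 5 L)) (*-rearrange (ℕtoℚ 5) (ℕtoℚ L) (c i))
      where
      *-rearrange : ∀ p q r → p * q * r ≡ p * (r * q)
      *-rearrange = solve-∀ ℚ-ring
    b≡3X+2X : b ≡ ℕtoℚ 3 * X + (X + X)
    b≡3X+2X = trans b≡5X (five-split X)
      where
      five-split : ∀ X → (1ℚ + 1ℚ + 1ℚ + 1ℚ + 1ℚ) * X ≡ (1ℚ + 1ℚ + 1ℚ) * X + (X + X)
      five-split = solve-∀ ℚ-ring

    increment≤2X : ∀ j → a j i * y j ≤ X + X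
    increment≤2X j = begin
      a j i * y j               ≤⟨ a*y≤ j i ⟩
      c i * ℕtoℚ (1 ℕ.+ L)      ≡⟨ cong (c i *_) (ℕtoℚ-+ 1 L) ⟩
      c i * (1ℚ + ℕtoℚ L)       ≡⟨ *-distribˡ-+ (c i) 1ℚ (ℕtoℚ L) ⟩
      c i * 1ℚ + X              ≡⟨ cong (_+ X) (*-identityʳ (c i)) ⟩
      c i + X                   ≤⟨ +-monoˡ-≤ X X≥c ⟩
      X + X                     ∎
      where open ≤-Reasoning
    2X≤b : X + X ≤ b
    2X≤b = subst (X + X ≤_) (sym b≡3X+2X) (p≤q+p′ 3X≥0)
    b<S[h] : b < S y i h
    b<S[h] = ≤-<-trans (*-monoʳ-≤-nonNeg′ (c≥0 i) (ℕtoℚ-mono-≤ (ℕ.*-monoˡ-≤ L {5} {10} (ℕ.+-monoʳ-≤ 5 z≤n))))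
                       S[h]>10X

    window : ∃ (LastPrefixBelow (λ j → a j i * y j) (X + X) b h) →
      Σ ℕ λ K → IsKi (suc h) y i K × (∃ λ j → (1 ℕ.≤ j) × (j ℕ.≤ K) × (0ℚ < a j i)) ×
        (ℕtoℚ 3 * X ≤ SP y i K) × (SP y i K ≤ ℕtoℚ 5 * X)
    window (K , 1≤K , K<h , S[K]≤b , above , b<S[K]+2X) =
      K , (1≤K , ℕ.m<n⇒m<1+n K<h , S[K]≤b , λ K' K<K' K'≤h → above K' K<K' (ℕ.≤-pred K'≤h)) ,
      SP-pos⇒P-nonempty y i K (≤-<-trans 3X≥0 3X<SP) , <⇒≤ 3X<SP ,
      subst₂ _≤_ (sym (SP≡S y i K)) b≡5X S[K]≤b
      where
      3X<SP : ℕtoℚ 3 * X < SP y i K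
      3X<SP = subst (ℕtoℚ 3 * X <_) (sym (SP≡S y i K))
                (+-cancelʳ-<′ (subst (_< S y i K + (X + X)) b≡3X+2X b<S[K]+2X))

lemma4 : ∀ {n : ℕ} (c : Fin n → ℚ) (a : ℕ → Fin n → ℚ) →
    (∀ i → 0ℚ < c i) →
    (∀ j i → 0ℚ ≤ a j i) →
    (∀ j → 1 ℕ.≤ j → ∃ λ i → 0ℚ < a j i) →
    ∀ (h : ℕ) (x : Fin n → ℚ) (y : ℕ → ℚ) (t : ℕ)
      (pre : List (Fin n)) (i : Fin n) (post : List (Fin n)) (y' : ℕ → ℚ) →
    AlgorithmI.Reach c a h x y →
    AlgorithmI.PrimalRuns c a (suc h) x (suc t) →
    AlgorithmI.OrderOf c a (suc h) (pre ++ i ∷ post) →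
    AlgorithmI.DualSteps c a (suc h) pre
      (set y (suc h) (AlgorithmI.dm c a (suc h) * ℕtoℚ (suc t))) y' →
    ℕtoℚ (10 ℕ.* AlgorithmI.logk c a (suc h)) * c i < AlgorithmI.S c a y' i h →
    Σ ℕ λ K →
      AlgorithmI.IsKi c a (suc h) y' i K ×
      (∃ λ j → (1 ℕ.≤ j) × (j ℕ.≤ K) × (0ℚ < a j i)) ×
      (ℕtoℚ 3 * (c i * ℕtoℚ (AlgorithmI.logk c a (suc h))) ≤ AlgorithmI.SP c a y' i K) ×
      (AlgorithmI.SP c a y' i K ≤ ℕtoℚ 5 * (c i * ℕtoℚ (AlgorithmI.logk c a (suc h))))
lemma4 c a c>0 a≥0 T-nonempty h x y t pre i post y' reach runs order steps S>10X =
  Kᵢ-window (DualBounded-steps pre pre⊆T steps after-run) S>10X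
  where
  open AlgorithmI c a using (logk; dm)
  open Analysis c a c>0 a≥0 T-nonempty
  after-run : DualBounded (logk (suc h)) (set y (suc h) (dm (suc h) * ℕtoℚ (suc t)))
  after-run = DualBounded-afterRun (Reach⇒primal-nonNeg reach) (Reach⇒DualBounded reach) runs
  pre⊆T : ∀ {i'} → i' ∈ pre → 0ℚ < a (suc h) i'
  pre⊆T i'∈pre = Equivalence.to (proj₂ order _) (∈-++⁺ˡ i'∈pre)
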